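{- Let $\mathbb{M}$ be a finite set of modalities and let $\mathsf{Ax}$ be any set of modal unfolding axioms over $\mathbb{M}$. Then the logics $\mathcal{L}_{\mathsf{Ax}}$ and $\mathcal{L}_{\widehat{\mathsf{Ax}}}$ are equivalent, i.e. a formula is provable in $\mathcal{L}_{\mathsf{Ax}}$ if and only if it is provable in $\mathcal{L}_{\widehat{\mathsf{Ax}}}$, where $\widehat{\mathsf{Ax}}$ is the reflexive and transitive closure of $\mathsf{Ax}$.
   Context: Formulas over a set of atomic tokens $\mathbb{T}$ and modalities $\mathbb{M}$: $A,B ::= \top \mid \bot \mid t \mid \mathcal{M}A \mid A\Rightarrow B \mid A\wedge B\mid A\vee B$ with $t\in\mathbb{T}$, $\mathcal{M}\in\mathbb{M}$. A modal unfolding axiom is a pair $(\mathcal{M}\Rrightarrow l)$ with $\mathcal{M}\in\mathbb{M}$ and $l\in\mathbb{M}^*$ a finite list of modalities; for $l$ a list, $l(A)$ is defined by $\varepsilon(A)=A$ and $(\mathcal{N}\cdot l)(A)=\mathcal{N}(l(A))$, and the axiom $\mathcal{M}\Rrightarrow l$ asserts $\mathcal{M}A\Rightarrow l(A)$ for every formula $A$. Given a set $\mathsf{Ax}$ of unfolding axioms, $\mathcal{L}_{\mathsf{Ax}}$ is intuitionistic propositional logic extended, for every modality $\mathcal{M}\in\mathbb{M}$, with axiom K ($\mathcal{M}A\Rightarrow\mathcal{M}(A\Rightarrow B)\Rightarrow\mathcal{M}B$) and the necessitation rule (if $\vdash A$ then $\vdash\mathcal{M}A$), and with all instances of the axioms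 in $\mathsf{Ax}$. The reflexive and transitive closure $\widehat{\mathsf{Ax}}$ is the smallest set of unfolding axioms containing $\mathsf{Ax}$, containing $\mathcal{M}\Rrightarrow\mathcal{M}$ for every $\mathcal{M}\in\mathbb{M}$, and such that whenever $\mathcal{M}\Rrightarrow l\cdot\mathcal{N}\cdot l'$ and $\mathcal{N}\Rrightarrow r$ are in it, so is $\mathcal{M}\Rrightarrow l\cdot r\cdot l'$. -}

module Defs where

open import Level using (Level; _⊔_; suc)
open import Data.List using (List; []; _∷_; _++_)
open import Data.Product using (_×_; ∃)
open import Data.List.Membership.Propositional using (_∈_)

data Form (T M : Set) : Set where
  ⊤′ ⊥′ : Form T M
  atom  : T → Form T M
  mod   : M → Form T M → Form T M
  _⇒_   : Form T M → Form T M → Form T M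
  _∧′_  : Form T M → Form T M → Form T M
  _∨′_  : Form T M → Form T M → Form T M

infixr 4 _⇒_
infixr 6 _∧′_
infixr 5 _∨′_

applyMods : {T M : Set} → List M → Form T M → Form T M
applyMods []      A = A
applyMods (N ∷ l) A = mod N (applyMods l A)

-- A set of unfolding axioms (M ⇛ l) is a predicate on pairs (M , l).
AxSet : (M : Set) → (ℓ : Level) → Set (Level.suc ℓ)
AxSet M ℓ = M → List M → Set ℓ

Finite : Set → Set
Finite M = ∃ λ (l : List M) → ∀ m → m ∈ l

data ⊢[_]_ {T M : Set} {ℓ : Level} (Ax : AxSet M ℓ) : Form T M → Set ℓ where
  ax-K   : ∀ {A B} → ⊢[ Ax ] (A ⇒ B ⇒ A)
  ax-S   : ∀ {A B C} → ⊢[ Ax ] ((A ⇒ B ⇒ C) ⇒ (A ⇒ B) ⇒ A ⇒ C)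
  ax-∧I  : ∀ {A B} → ⊢[ Ax ] (A ⇒ B ⇒ A ∧′ B)
  ax-∧E₁ : ∀ {A B} → ⊢[ Ax ] (A ∧′ B ⇒ A)
  ax-∧E₂ : ∀ {A B} → ⊢[ Ax ] (A ∧′ B ⇒ B)
  ax-∨I₁ : ∀ {A B} → ⊢[ Ax ] (A ⇒ A ∨′ B)
  ax-∨I₂ : ∀ {A B} → ⊢[ Ax ] (B ⇒ A ∨′ B)
  ax-∨E  : ∀ {A B C} → ⊢[ Ax ] ((A ⇒ C) ⇒ (B ⇒ C) ⇒ A ∨′ B ⇒ C)
  ax-⊥E  : ∀ {A} → ⊢[ Ax ] (⊥′ ⇒ A)
  ax-⊤I  : ⊢[ Ax ] ⊤′
  mp     : ∀ {A B} → ⊢[ Ax ] (A ⇒ B) → ⊢[ Ax ] A → ⊢[ Ax ] B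
  ax-□K  : ∀ {m A B} → ⊢[ Ax ] (mod m A ⇒ mod m (A ⇒ B) ⇒ mod m B)
  nec    : ∀ {m A} → ⊢[ Ax ] A → ⊢[ Ax ] mod m A
  ax-unf : ∀ {m l A} → Ax m l → ⊢[ Ax ] (mod m A ⇒ applyMods l A)

data Closure {M : Set} {ℓ : Level} (Ax : AxSet M ℓ) : AxSet M ℓ where
  base  : ∀ {m l} → Ax m l → Closure Ax m l
  refl′ : ∀ {m} → Closure Ax m (m ∷ [])
  trans′ : ∀ {m n l l′ r} → Closure Ax m (l ++ (n ∷ l′)) → Closure Ax n r
         → Closure Ax m (l ++ r ++ l′)

_≡ₗ_ : {T M : Set} {ℓ₁ ℓ₂ : Level} → AxSet M ℓ₁ → AxSet M ℓ₂ → Set (ℓ₁ ⊔ ℓ₂)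
_≡ₗ_ {T} {M} Ax Ax′ = (A : Form T M) → (⊢[ Ax ] A → ⊢[ Ax′ ] A) × (⊢[ Ax′ ] A → ⊢[ Ax ] A)

-- Every theorem of L_Ax is one of L_Âx since Ax ⊆ Âx.  Conversely it suffices
-- that every unfolding axiom of Âx is already a theorem of L_Ax, which follows
-- by induction on the closure: reflexivity is A ⇒ A, and transitivity composes
-- M A ⇒ l(N(l′ A)) with the image of N(l′ A) ⇒ r(l′ A) under the monotone map l.
module Submission where

open import Defs
open import Level using (Level)
open import Data.List using (List; []; _∷_; _++_)
open import Data.Product using (_,_)
open import Relation.Binary.PropositionalEquality using (_≡_; refl; sym; cong; subst)
open Relation.Binary.PropositionalEquality.≡-Reasoning
open import Function using (_∘_)

module _ {T M : Set} where

  applyMods-++ : (l r : List M) (A : Form T M) →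
                 applyMods (l ++ r) A ≡ applyMods l (applyMods r A)
  applyMods-++ []      r A = refl
  applyMods-++ (N ∷ l) r A = cong (mod N) (applyMods-++ l r A)

  applyMods-++-++ : (l r l′ : List M) (A : Form T M) →
                    applyMods (l ++ r ++ l′) A ≡ applyMods l (applyMods r (applyMods l′ A))
  applyMods-++-++ l r l′ A = begin
    applyMods (l ++ r ++ l′) A                ≡⟨ applyMods-++ l (r ++ l′) A ⟩
    applyMods l (applyMods (r ++ l′) A)       ≡⟨ cong (applyMods l) (applyMods-++ r l′ A) ⟩
    applyMods l (applyMods r (applyMods l′ A)) ∎

  module _ {ℓ : Level} {Ax : AxSet M ℓ} where

    ⇒-refl : {A : Form T M} → ⊢[ Ax ] (A ⇒ A)
    ⇒-refl {A} = mp (mp ax-S ax-K) (ax-K {B = A ⇒ A})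

    ⇒-trans : {A B C : Form T M} → ⊢[ Ax ] (A ⇒ B) → ⊢[ Ax ] (B ⇒ C) → ⊢[ Ax ] (A ⇒ C)
    ⇒-trans ab bc = mp (mp ax-S (mp ax-K bc)) ab

    ⇒-substʳ : {A B C : Form T M} → B ≡ C → ⊢[ Ax ] (A ⇒ B) → ⊢[ Ax ] (A ⇒ C)
    ⇒-substʳ {A} = subst (λ X → ⊢[ Ax ] (A ⇒ X))

    mod-mono : {N : M} {A B : Form T M} → ⊢[ Ax ] (A ⇒ B) → ⊢[ Ax ] (mod N A ⇒ mod N B)
    mod-mono ab = mp (mp ax-S ax-□K) (mp ax-K (nec ab))

    applyMods-mono : (l : List M) {A B : Form T M} →
                     ⊢[ Ax ] (A ⇒ B) → ⊢[ Ax ] (applyMods l A ⇒ applyMods l B)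
    applyMods-mono []      ab = ab
    applyMods-mono (N ∷ l) ab = mod-mono (applyMods-mono l ab)

  Unfolds : {ℓ : Level} → AxSet M ℓ → AxSet M ℓ
  Unfolds Ax N l = (A : Form T M) → ⊢[ Ax ] (mod N A ⇒ applyMods l A)

  ⊢-unfolds : {ℓ : Level} {Ax : AxSet M ℓ} {N : M} {l : List M} → Ax N l → Unfolds Ax N l
  ⊢-unfolds a A = ax-unf a

  closure-unfolds : {ℓ : Level} {Ax : AxSet M ℓ} {N : M} {l : List M} →
                    Closure Ax N l → Unfolds Ax N l
  closure-unfolds (base a) = ⊢-unfolds a
  closure-unfolds refl′    A = ⇒-refl
  closure-unfolds (trans′ {l = l} {l′} {r} c d) A =
    ⇒-substʳ (sym (applyMods-++-++ l r l′ A))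
      (⇒-trans (⇒-substʳ (applyMods-++ l (_ ∷ l′) A) (closure-unfolds c A))
               (applyMods-mono l (closure-unfolds d (applyMods l′ A))))

  ⊢-transfer : {ℓ ℓ′ : Level} {Ax : AxSet M ℓ} {Ax′ : AxSet M ℓ′} →
               (∀ {N l} → Ax N l → Unfolds Ax′ N l) →
               {A : Form T M} → ⊢[ Ax ] A → ⊢[ Ax′ ] A
  ⊢-transfer unf ax-K       = ax-K
  ⊢-transfer unf ax-S       = ax-S
  ⊢-transfer unf ax-∧I      = ax-∧I
  ⊢-transfer unf ax-∧E₁     = ax-∧E₁
  ⊢-transfer unf ax-∧E₂     = ax-∧E₂
  ⊢-transfer unf ax-∨I₁     = ax-∨I₁
  ⊢-transfer unf ax-∨I₂     = ax-∨I₂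
  ⊢-transfer unf ax-∨E      = ax-∨E
  ⊢-transfer unf ax-⊥E      = ax-⊥E
  ⊢-transfer unf ax-⊤I      = ax-⊤I
  ⊢-transfer unf (mp p q)   = mp (⊢-transfer unf p) (⊢-transfer unf q)
  ⊢-transfer unf ax-□K      = ax-□K
  ⊢-transfer unf (nec p)    = nec (⊢-transfer unf p)
  ⊢-transfer unf (ax-unf a) = unf a _

lemma1 : {ℓ : Level} (T M : Set) → Finite M → (Ax : AxSet M ℓ) →
    _≡ₗ_ {T} {M} Ax (Closure Ax)
lemma1 T M _ Ax A = ⊢-transfer (⊢-unfolds ∘ base) , ⊢-transfer closure-unfolds
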